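{- Let $\sigma:\Delta\to\Gamma$ be a morphism of presheaves over $\mathrm{BPCube}$ and $\Gamma\vdash T$ a type. Then the shape equivalence relation respects substitution: $\mathrm{SE}^T[\sigma]=\mathrm{SE}^{T[\sigma]}$ as equivalence relations on $T[\sigma]$.
   Context: Fix an infinite set of names. $\mathrm{BPCube}$ has as objects pairs $W=(W_{\mathbb B},W_{\mathbb P})$ of disjoint finite sets of names; $(W,i:\mathbb P)$ denotes $(W_{\mathbb B},W_{\mathbb P}\uplus\{i\})$ for a fresh name $i$. A morphism $\varphi:V\to W$ assigns to each $i\in W_{\mathbb B}$ an element of $\{0,1\}\cup V_{\mathbb B}$ and to each $i\in W_{\mathbb P}$ an element of $\{0,1\}\cup V_{\mathbb B}\cup V_{\mathbb P}$; composition is substitution. $\mathrm{wk}_i:(W,i:\mathbb P)\to W$ sends every name of $W$ to itself, and $(0/i,\mathrm{wk}_i):(W,i:\mathbb P)\to(W,i:\mathbb P)$ sends $i$ to $0$ and every other name to itself. A type $\Gamma\vdash T$ gives sets $T[\gamma]$ ($\gamma\in\Gamma(W)$) with functorial restrictions $t\mapsto t\langle\varphi\rangle\in T[\gamma\cdot\varphi]$; $T[\sigma][\delta]=T[\sigma\delta]$. An equivalence relation $E$ on $T$ is a family of equivalence relations $E[\gamma]$ on $T[\gamma]$ such that $E[\gamma](s,t)$ implies $E[\gamma\cdot\varphi](s\langle\varphi\rangle,t\langle\varphi\rangle)$; its substitution is $E[\sigma][\delta]=E[\sigma\delta]$. The shape equivalence relation $\mathrm{SE}^T$ is the smallest equivalence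 relation on $T$ such that for all $W$, fresh names $i$, $\gamma\in\Gamma(W)$ and $p\in T[\gamma\cdot\mathrm{wk}_i]$ we have $\mathrm{SE}^T[\gamma\cdot\mathrm{wk}_i](p,p\langle(0/i,\mathrm{wk}_i)\rangle)$. -}

module Defs where

open import Level using (Level; _⊔_) renaming (suc to lsuc)
open import Data.Nat using (ℕ; _≟_)
open import Data.Product using (_×_; _,_; proj₁; proj₂)
open import Data.List using (List; _∷_)
open import Data.List.Membership.Propositional using (_∈_; _∉_)
open import Data.List.Relation.Unary.Any using (here; there)
open import Data.List.Relation.Unary.All.Properties using (¬Any⇒All¬)
open import Data.List.Relation.Unary.Unique.Propositional using (Unique)
open import Data.List.Relation.Unary.AllPairs using (_∷_)
open import Data.List.Relation.Binary.Disjoint.Propositional using (Disjoint)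
import Data.Empty.Irrelevant as Irr
open import Relation.Nullary using (yes; no)
open import Relation.Binary.PropositionalEquality
  using (_≡_; refl; sym; trans; cong; subst)
open import Relation.Binary.Structures using (IsEquivalence)
open import Function.Bundles using (_⇔_)
open import Axiom.UniquenessOfIdentityProofs.WithK using (uip)

-- An object is a pair (W_B , W_P) of finite sets of names, represented
-- by duplicate-free, disjoint lists (the invariant is an irrelevant field).

record Ctx : Set where
  constructor ctx
  field
    B P   : List ℕ
    .uniqB : Unique B
    .uniqP : Unique P
    .disj  : Disjoint B P
open Ctx public

data ValB (V : Ctx) : Set where
  b0 b1 : ValB V
  bn    : (j : ℕ) → .(j ∈ B V) → ValB V

data ValP (V : Ctx) : Set where
  p0 p1 : ValP V
  pB    : (j : ℕ) → .(j ∈ B V) → ValP V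
  pP    : (j : ℕ) → .(j ∈ P V) → ValP V

-- A morphism V → W assigns values in V to the names of W.
record Hom (V W : Ctx) : Set where
  constructor hom
  field
    fB : (i : ℕ) → .(i ∈ B W) → ValB V
    fP : (i : ℕ) → .(i ∈ P W) → ValP V
open Hom public

record _≈H_ {V W : Ctx} (φ ψ : Hom V W) : Set where
  field
    eqB : (i : ℕ) .(m : i ∈ B W) → fB φ i m ≡ fB ψ i m
    eqP : (i : ℕ) .(m : i ∈ P W) → fP φ i m ≡ fP ψ i m

idH : ∀ {W} → Hom W W
idH = hom (λ i m → bn i m) (λ i m → pP i m)

ValB⇒ValP : ∀ {V} → ValB V → ValP V
ValB⇒ValP b0 = p0
ValB⇒ValP b1 = p1
ValB⇒ValP (bn j m) = pB j m

substB : ∀ {U V} → Hom U V → ValB V → ValB U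
substB φ b0 = b0
substB φ b1 = b1
substB φ (bn j m) = fB φ j m

substP : ∀ {U V} → Hom U V → ValP V → ValP U
substP φ p0 = p0
substP φ p1 = p1
substP φ (pB j m) = ValB⇒ValP (fB φ j m)
substP φ (pP j m) = fP φ j m

_∘H_ : ∀ {U V W} → Hom V W → Hom U V → Hom U W
ψ ∘H φ = hom (λ i m → substB φ (fB ψ i m)) (λ i m → substP φ (fP ψ i m))

Fresh : ℕ → Ctx → Set
Fresh i W = i ∉ B W × i ∉ P W

private
  disj-ext : ∀ {i} (Bs Ps : List ℕ) → i ∉ Bs → Disjoint Bs Ps → Disjoint Bs (i ∷ Ps)
  disj-ext Bs Ps i∉ d (v∈B , here refl) = i∉ v∈B
  disj-ext Bs Ps i∉ d (v∈B , there v∈P) = d (v∈B , v∈P)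

_,P_∶_ : (W : Ctx) (i : ℕ) → .(Fresh i W) → Ctx
ctx Bs Ps uB uP d ,P i ∶ fr = ctx Bs (i ∷ Ps) uB
                  (¬Any⇒All¬ Ps (proj₂ fr) ∷ uP)
                  (disj-ext Bs Ps (proj₁ fr) d)

wk : ∀ {W} i .(fr : Fresh i W) → Hom (W ,P i ∶ fr) W
wk i fr = hom (λ j m → bn j m) (λ j m → pP j (there m))

zeroAt : ∀ {W} i .(fr : Fresh i W) → Hom (W ,P i ∶ fr) (W ,P i ∶ fr)
zeroAt i fr = hom (λ j m → bn j m) f
  where
  f : (j : ℕ) → .(j ∈ i ∷ _) → ValP _
  f j m with j ≟ i
  ... | yes _ = p0
  ... | no  _ = pP j m

wk∘zeroAt : ∀ {W} i .(fr : Fresh i W) → (wk {W} i fr ∘H zeroAt {W} i fr) ≈H wk {W} i fr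
wk∘zeroAt {W} i fr = record { eqB = λ j m → refl ; eqP = eqP′ }
  where
  eqP′ : (j : ℕ) .(m : j ∈ P W) →
         fP (wk {W} i fr ∘H zeroAt {W} i fr) j m ≡ fP (wk {W} i fr) j m
  eqP′ j m with j ≟ i
  ... | yes refl = Irr.⊥-elim (proj₂ fr m)
  ... | no  _    = refl

record Psh (ℓ : Level) : Set (lsuc ℓ) where
  infixl 5 _·_
  field
    Ob     : Ctx → Set ℓ
    _·_    : ∀ {V W} → Ob W → Hom V W → Ob V
    ·-id   : ∀ {W} (γ : Ob W) → γ · idH ≡ γ
    ·-∘    : ∀ {U V W} (γ : Ob W) (ψ : Hom V W) (φ : Hom U V) →
             γ · (ψ ∘H φ) ≡ (γ · ψ) · φ
    ·-resp : ∀ {V W} (γ : Ob W) {φ ψ : Hom V W} → φ ≈H ψ → γ · φ ≡ γ · ψ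
open Psh public using (Ob; ·-id; ·-∘; ·-resp)

record PshHom {ℓ₁ ℓ₂} (Δ : Psh ℓ₁) (Γ : Psh ℓ₂) : Set (ℓ₁ ⊔ ℓ₂) where
  field
    map : ∀ {W} → Ob Δ W → Ob Γ W
    nat : ∀ {V W} (δ : Ob Δ W) (φ : Hom V W) →
          map (Psh._·_ Δ δ φ) ≡ Psh._·_ Γ (map δ) φ
open PshHom public

record Ty {ℓ} (Γ : Psh ℓ) (ℓ′ : Level) : Set (ℓ ⊔ lsuc ℓ′) where
  open Psh Γ using (_·_)
  field
    Fib   : ∀ {W} → Ob Γ W → Set ℓ′
    _⟨_⟩  : ∀ {V W} {γ : Ob Γ W} → Fib γ → (φ : Hom V W) → Fib (γ · φ)
    ⟨id⟩  : ∀ {W} {γ : Ob Γ W} (t : Fib γ) →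
            subst Fib (·-id Γ γ) (t ⟨ idH ⟩) ≡ t
    ⟨∘⟩   : ∀ {U V W} {γ : Ob Γ W} (t : Fib γ) (ψ : Hom V W) (φ : Hom U V) →
            subst Fib (·-∘ Γ γ ψ φ) (t ⟨ ψ ∘H φ ⟩) ≡ (t ⟨ ψ ⟩) ⟨ φ ⟩
    ⟨resp⟩ : ∀ {V W} {γ : Ob Γ W} (t : Fib γ) {φ ψ : Hom V W} (e : φ ≈H ψ) →
            subst Fib (·-resp Γ γ e) (t ⟨ φ ⟩) ≡ t ⟨ ψ ⟩
open Ty public

private
  substs : ∀ {a b} {A : Set a} (F : A → Set b) {x y z : A}
           (p : x ≡ y) (q : y ≡ z) (r : x ≡ z) (u : F x) →
           subst F q (subst F p u) ≡ subst F r u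
  substs F refl refl refl u = refl

  subst-map : ∀ {a b c} {A : Set a} {C : Set c} (F : C → Set b) (g : A → C)
              {x y : A} (p : x ≡ y) (u : F (g x)) →
              subst (λ d → F (g d)) p u ≡ subst F (cong g p) u
  subst-map F g refl u = refl

  subst-uip : ∀ {a b} {A : Set a} (F : A → Set b) {x y : A}
              (p q : x ≡ y) (u : F x) → subst F p u ≡ subst F q u
  subst-uip F p q u = cong (λ r → subst F r u) (uip p q)

_[_]ᵀ : ∀ {ℓ₁ ℓ₂ ℓ′} {Δ : Psh ℓ₁} {Γ : Psh ℓ₂} →
        Ty Γ ℓ′ → PshHom Δ Γ → Ty Δ ℓ′
_[_]ᵀ {Δ = Δ} {Γ} T σ = record
  { Fib    = λ δ → Fib T (map σ δ)
  ; _⟨_⟩   = rs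
  ; ⟨id⟩   = λ {W} {δ} t →
      trans (subst-map (Fib T) (map σ) (·-id Δ δ) (rs t idH))
     (trans (substs (Fib T) (sym (nat σ δ idH)) (cong (map σ) (·-id Δ δ))
                    (·-id Γ (map σ δ)) (_⟨_⟩ T t idH))
            (⟨id⟩ T t))
  ; ⟨∘⟩    = λ {U} {V} {W} {δ} t ψ φ →
      let A  = sym (nat σ δ (ψ ∘H φ))
          Bp = cong (map σ) (·-∘ Δ δ ψ φ)
          C  = ·-∘ Γ (map σ δ) ψ φ
          D  = cong (λ g → Psh._·_ Γ g φ) (sym (nat σ δ ψ))
          E  = sym (nat σ (Psh._·_ Δ δ ψ) φ)
          X  = _⟨_⟩ T t (ψ ∘H φ)
      in
      trans (subst-map (Fib T) (map σ) (·-∘ Δ δ ψ φ) (rs t (ψ ∘H φ)))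
     (trans (substs (Fib T) A Bp (trans A Bp) X)
     (trans (subst-uip (Fib T) (trans A Bp) (trans C (trans D E)) X)
     (trans (sym (substs (Fib T) C (trans D E) (trans C (trans D E)) X))
     (trans (cong (subst (Fib T) (trans D E)) (⟨∘⟩ T t ψ φ))
     (trans (sym (substs (Fib T) D E (trans D E) (_⟨_⟩ T (_⟨_⟩ T t ψ) φ)))
            (cong (subst (Fib T) E)
                  (sym (restr-subst (sym (nat σ δ ψ)) φ (_⟨_⟩ T t ψ)))))))))
  ; ⟨resp⟩ = λ {V} {W} {δ} t {φ} {ψ} e →
      trans (subst-map (Fib T) (map σ) (·-resp Δ δ e) (rs t φ))
     (trans (substs (Fib T) (sym (nat σ δ φ)) (cong (map σ) (·-resp Δ δ e))
                    (trans (·-resp Γ (map σ δ) e) (sym (nat σ δ ψ))) (_⟨_⟩ T t φ))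
     (trans (sym (substs (Fib T) (·-resp Γ (map σ δ) e) (sym (nat σ δ ψ)) _ (_⟨_⟩ T t φ)))
            (cong (subst (Fib T) (sym (nat σ δ ψ))) (⟨resp⟩ T t e))))
  }
  where
  rs : ∀ {V W} {δ : Ob Δ W} → Fib T (map σ δ) → (φ : Hom V W) →
       Fib T (map σ (Psh._·_ Δ δ φ))
  rs {δ = δ} t φ = subst (Fib T) (sym (nat σ δ φ)) (_⟨_⟩ T t φ)

  restr-subst : ∀ {U V} {γ γ′ : Ob Γ V} (p : γ ≡ γ′) (φ : Hom U V) (u : Fib T γ) →
                _⟨_⟩ T (subst (Fib T) p u) φ ≡ subst (Fib T) (cong (λ g → Psh._·_ Γ g φ) p) (_⟨_⟩ T u φ)
  restr-subst refl φ u = refl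

record EqRel {ℓ ℓ′} {Γ : Psh ℓ} (T : Ty Γ ℓ′) (ℓr : Level) : Set (ℓ ⊔ ℓ′ ⊔ lsuc ℓr) where
  field
    R      : ∀ {W} (γ : Ob Γ W) → Fib T γ → Fib T γ → Set ℓr
    isEq   : ∀ {W} (γ : Ob Γ W) → IsEquivalence (R γ)
    stable : ∀ {V W} {γ : Ob Γ W} {s t : Fib T γ} (φ : Hom V W) →
             R γ s t → R (Psh._·_ Γ γ φ) (_⟨_⟩ T s φ) (_⟨_⟩ T t φ)
open EqRel public

_[_]ᴱ : ∀ {ℓ₁ ℓ₂ ℓ′ ℓr} {Δ : Psh ℓ₁} {Γ : Psh ℓ₂} {T : Ty Γ ℓ′} →
        EqRel T ℓr → (σ : PshHom Δ Γ) → EqRel (T [ σ ]ᵀ) ℓr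
_[_]ᴱ {Δ = Δ} {Γ} {T} E σ = record
  { R      = λ δ → R E (map σ δ)
  ; isEq   = λ δ → isEq E (map σ δ)
  ; stable = λ {V} {W} {δ} φ r → tr (sym (nat σ δ φ)) (stable E φ r)
  }
  where
  tr : ∀ {W} {γ γ′ : Ob Γ W} (p : γ ≡ γ′) {s t : Fib T γ} →
       R E γ s t → R E γ′ (subst (Fib T) p s) (subst (Fib T) p t)
  tr refl r = r

_≐_ : ∀ {ℓ ℓ′ ℓr ℓs} {Γ : Psh ℓ} {T : Ty Γ ℓ′} → EqRel T ℓr → EqRel T ℓs → Set _
_≐_ {Γ = Γ} {T} E F =
  ∀ {W} (γ : Ob Γ W) (s t : Fib T γ) → R E γ s t ⇔ R F γ s t

module _ {ℓ ℓ′} {Γ : Psh ℓ} (T : Ty Γ ℓ′) where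
  open Psh Γ using (_·_)

  wkz-path : ∀ {W} i .(fr : Fresh i W) (γ : Ob Γ W) →
             (γ · wk {W} i fr) · zeroAt {W} i fr ≡ γ · wk {W} i fr
  wkz-path {W} i fr γ = trans (sym (·-∘ Γ γ (wk {W} i fr) (zeroAt {W} i fr)))
                              (·-resp Γ γ (wk∘zeroAt {W} i fr))

  data SERel : ∀ {W} (γ : Ob Γ W) → Fib T γ → Fib T γ → Set (ℓ ⊔ ℓ′) where
    gen : ∀ {W} i .(fr : Fresh i W) (γ : Ob Γ W) (p : Fib T (γ · wk {W} i fr)) →
          SERel (γ · wk {W} i fr) p
                (subst (Fib T) (wkz-path {W} i fr γ) (_⟨_⟩ T p (zeroAt {W} i fr)))
    rfl  : ∀ {W} {γ : Ob Γ W} {s} → SERel γ s s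
    sym′ : ∀ {W} {γ : Ob Γ W} {s t} → SERel γ s t → SERel γ t s
    trn  : ∀ {W} {γ : Ob Γ W} {s t u} → SERel γ s t → SERel γ t u → SERel γ s u
    rst  : ∀ {V W} {γ : Ob Γ W} {s t} (φ : Hom V W) →
           SERel γ s t → SERel (γ · φ) (_⟨_⟩ T s φ) (_⟨_⟩ T t φ)

  SE : EqRel T (ℓ ⊔ ℓ′)
  SE = record
    { R      = SERel
    ; isEq   = λ γ → record { refl = rfl ; sym = sym′ ; trans = trn }
    ; stable = rst
    }

module Submission where

-- SE^T is, by definition, the least family of equivalence relations on T that
-- is closed under restriction and relates every p over γ·wk_i to p⟨0/i⟩.
-- Both inclusions are therefore instances of one induction principle,
-- `SE-least`: SE^T is contained in every equivalence relation on T that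
-- contains these generating pairs.
--
-- * SE^{T[σ]} ⊆ SE^T[σ]: a generating pair of T[σ] over δ·wk_i is, read in T,
--   a generating pair of T over σ(δ)·wk_i.
-- * SE^T[σ] ⊆ SE^{T[σ]}: relate s, t over γ when for every φ : V → W and every
--   δ over γ·φ the restrictions s⟨φ⟩, t⟨φ⟩ are SE^{T[σ]}-related over δ.  This
--   is an equivalence relation closed under restriction, and it contains the
--   generators because every φ : V → (W, i:P) factors through the generating
--   square (0/j , wk_j) of a name j fresh for V (`GeneratorSquare`).  Taking
--   φ = id gives the inclusion.

open import Defs
open import Level using (_⊔_)
open import Data.Nat using (ℕ; suc; _≟_)
open import Data.Nat.Properties using (1+n≰n)
open import Data.Product using (_,_; proj₂)
open import Data.List using (List; _∷_; _++_)
open import Data.List.Extrema.Nat using (max; xs≤max)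
open import Data.List.Membership.Propositional using (_∈_; _∉_)
open import Data.List.Membership.Propositional.Properties using (∈-++⁺ˡ; ∈-++⁺ʳ)
open import Data.List.Relation.Unary.All as All using ()
open import Data.List.Relation.Unary.Any as Any using (here; there)
import Data.Empty.Irrelevant as Irr
open import Data.Empty using (⊥-elim)
open import Relation.Nullary using (yes; no)
open import Relation.Binary.Structures using (IsEquivalence)
open import Relation.Binary.PropositionalEquality as P
  using (_≡_; refl; subst; cong; module ≡-Reasoning)
open import Relation.Binary.HeterogeneousEquality as H
  using (_≅_; refl; ≡-to-≅; ≡-subst-removable; module ≅-Reasoning)
open import Function.Bundles using (mk⇔)

freshFor : List ℕ → ℕ
freshFor xs = suc (max 0 xs)

freshFor-∉ : (xs : List ℕ) → freshFor xs ∉ xs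
freshFor-∉ xs m = 1+n≰n (All.lookup (xs≤max 0 xs) m)

freshName : Ctx → ℕ
freshName V = freshFor (B V ++ P V)

freshName-fresh : (V : Ctx) → Fresh (freshName V) V
freshName-fresh V =
  (λ m → freshFor-∉ (B V ++ P V) (∈-++⁺ˡ m)) ,
  (λ m → freshFor-∉ (B V ++ P V) (∈-++⁺ʳ (B V) m))

-- Given φ : V → (W , i:P) and a name j fresh for V, φ factors as
--   V --instantiate--> (V , j:P) --rename--> (W , i:P),
-- where `rename` sends i to j and `instantiate` sends j to φ(i), all other
-- names as φ resp. to themselves.
module GeneratorSquare {W : Ctx} (i : ℕ) .(fr : Fresh i W) {V : Ctx}
                       (φ : Hom V (W ,P i ∶ fr)) (j : ℕ) .(frj : Fresh j V) where

  Vj : Ctx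
  Vj = V ,P j ∶ frj

  Wi : Ctx
  Wi = W ,P i ∶ fr

  wkᵢ : Hom Wi W
  wkᵢ = wk {W} i fr

  zeroᵢ : Hom Wi Wi
  zeroᵢ = zeroAt {W} i fr

  wkⱼ : Hom Vj V
  wkⱼ = wk {V} j frj

  zeroⱼ : Hom Vj Vj
  zeroⱼ = zeroAt {V} j frj

  wkB : ValB V → ValB Vj
  wkB b0       = b0
  wkB b1       = b1
  wkB (bn l m) = bn l m

  wkP : ValP V → ValP Vj
  wkP p0       = p0
  wkP p1       = p1
  wkP (pB l m) = pB l m
  wkP (pP l m) = pP l (there m)

  renameP : (k : ℕ) → .(k ∈ i ∷ P W) → ValP Vj
  renameP k m with k ≟ i
  ... | yes _ = pP j (here refl)
  ... | no  _ = wkP (fP φ k m)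

  rename : Hom Vj Wi
  rename = hom (λ k m → wkB (fB φ k m)) renameP

  instantiateP : (k : ℕ) → .(k ∈ j ∷ P V) → ValP V
  instantiateP k m with k ≟ j
  ... | yes _   = fP φ i (here refl)
  ... | no  k≢j = pP k (Any.tail k≢j m)

  instantiate : Hom V Vj
  instantiate = hom (λ k m → bn k m) instantiateP

  instantiate-j : .(m : j ∈ j ∷ P V) → instantiateP j m ≡ fP φ i (here refl)
  instantiate-j m with j ≟ j
  ... | yes _ = refl
  ... | no  j≢j = ⊥-elim (j≢j refl)

  instantiate-old : ∀ k .(m : k ∈ P V) → instantiateP k (there m) ≡ pP k m
  instantiate-old k m with k ≟ j
  ... | yes refl = Irr.⊥-elim (proj₂ frj m)
  ... | no  _    = refl

  instantiate-wkB : ∀ v → substB instantiate (wkB v) ≡ v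
  instantiate-wkB b0       = refl
  instantiate-wkB b1       = refl
  instantiate-wkB (bn l m) = refl

  instantiate-wkP : ∀ v → substP instantiate (wkP v) ≡ v
  instantiate-wkP p0       = refl
  instantiate-wkP p1       = refl
  instantiate-wkP (pB l m) = refl
  instantiate-wkP (pP l m) = instantiate-old l m

  zeroAt-wkB : ∀ v → substB zeroⱼ (wkB v) ≡ wkB v
  zeroAt-wkB b0       = refl
  zeroAt-wkB b1       = refl
  zeroAt-wkB (bn l m) = refl

  zeroAt-wkP : ∀ v → substP zeroⱼ (wkP v) ≡ wkP v
  zeroAt-wkP p0       = refl
  zeroAt-wkP p1       = refl
  zeroAt-wkP (pB l m) = refl
  zeroAt-wkP (pP l m) with l ≟ j
  ... | yes refl = Irr.⊥-elim (proj₂ frj m)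
  ... | no  _    = refl

  zeroAt-j : .(m : j ∈ j ∷ P V) → fP zeroⱼ j m ≡ p0
  zeroAt-j m with j ≟ j
  ... | yes _   = refl
  ... | no  j≢j = ⊥-elim (j≢j refl)

  wk-substB : ∀ v → substB wkⱼ v ≡ wkB v
  wk-substB b0       = refl
  wk-substB b1       = refl
  wk-substB (bn l m) = refl

  wk-substP : ∀ v → substP wkⱼ v ≡ wkP v
  wk-substP p0       = refl
  wk-substP p1       = refl
  wk-substP (pB l m) = refl
  wk-substP (pP l m) = refl

  rename∘instantiate : (rename ∘H instantiate) ≈H φ
  rename∘instantiate = record { eqB = λ k m → instantiate-wkB (fB φ k m) ; eqP = eqP′ }
    where
    eqP′ : ∀ k .(m : k ∈ i ∷ P W) → substP instantiate (renameP k m) ≡ fP φ k m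
    eqP′ k m with k ≟ i
    ... | yes refl = instantiate-j (here refl)
    ... | no  _    = instantiate-wkP (fP φ k m)

  rename∘zeroAt∘instantiate :
    ((rename ∘H zeroⱼ) ∘H instantiate) ≈H (zeroᵢ ∘H φ)
  rename∘zeroAt∘instantiate = record { eqB = eqB′ ; eqP = eqP′ }
    where
    eqB′ : ∀ k .(m : k ∈ B W) →
           substB instantiate (substB zeroⱼ (wkB (fB φ k m))) ≡ fB φ k m
    eqB′ k m = P.trans (cong (substB instantiate) (zeroAt-wkB (fB φ k m)))
                       (instantiate-wkB (fB φ k m))
    eqP′ : ∀ k .(m : k ∈ i ∷ P W) →
           substP instantiate (substP zeroⱼ (renameP k m))
             ≡ substP φ (fP zeroᵢ k m)
    eqP′ k m with k ≟ i
    ... | yes refl = cong (substP instantiate) (zeroAt-j (here refl))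
    ... | no  _    = P.trans (cong (substP instantiate) (zeroAt-wkP (fP φ k m)))
                             (instantiate-wkP (fP φ k m))

  wk∘instantiate : (wkⱼ ∘H instantiate) ≈H idH
  wk∘instantiate = record { eqB = λ k m → refl ; eqP = instantiate-old }

  wk∘rename : (wkᵢ ∘H rename) ≈H ((wkᵢ ∘H φ) ∘H wkⱼ)
  wk∘rename = record { eqB = λ k m → P.sym (wk-substB (fB φ k m)) ; eqP = eqP′ }
    where
    eqP′ : ∀ k .(m : k ∈ P W) → renameP k (there m) ≡ substP wkⱼ (fP φ k (there m))
    eqP′ k m with k ≟ i
    ... | yes refl = Irr.⊥-elim (proj₂ fr m)
    ... | no  _    = P.sym (wk-substP (fP φ k (there m)))

≅-transport : ∀ {a f r} {A : Set a} (F : A → Set f) (Rel : ∀ x → F x → F x → Set r)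
              {x x′ : A} {s t : F x} {s′ t′ : F x′} →
              x ≡ x′ → s ≅ s′ → t ≅ t′ → Rel x s t → Rel x′ s′ t′
≅-transport F Rel refl refl refl r = r

module Restriction {ℓ ℓ′} {Γ : Psh ℓ} (T : Ty Γ ℓ′) where
  open Psh Γ using (_·_)
  open Ty T using () renaming (_⟨_⟩ to _↾_)

  transport-≅ : ∀ {W} {γ γ′ : Ob Γ W} (e : γ ≡ γ′) (t : Fib T γ) → subst (Fib T) e t ≅ t
  transport-≅ e t = ≡-subst-removable (Fib T) e t

  restrict-cong : ∀ {V W} {γ γ′ : Ob Γ W} {t : Fib T γ} {t′ : Fib T γ′} (φ : Hom V W) →
                  γ ≡ γ′ → t ≅ t′ → t ↾ φ ≅ t′ ↾ φ
  restrict-cong φ refl refl = refl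

  restrict-id : ∀ {W} {γ : Ob Γ W} (t : Fib T γ) → t ↾ idH ≅ t
  restrict-id {γ = γ} t = H.trans (H.sym (transport-≅ (·-id Γ γ) _)) (≡-to-≅ (⟨id⟩ T t))

  restrict-∘ : ∀ {U V W} {γ : Ob Γ W} (t : Fib T γ) (ψ : Hom V W) (φ : Hom U V) →
               t ↾ (ψ ∘H φ) ≅ (t ↾ ψ) ↾ φ
  restrict-∘ {γ = γ} t ψ φ =
    H.trans (H.sym (transport-≅ (·-∘ Γ γ ψ φ) _)) (≡-to-≅ (⟨∘⟩ T t ψ φ))

  restrict-≈ : ∀ {V W} {γ : Ob Γ W} (t : Fib T γ) {φ ψ : Hom V W} →
               φ ≈H ψ → t ↾ φ ≅ t ↾ ψ
  restrict-≈ {γ = γ} t e =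
    H.trans (H.sym (transport-≅ (·-resp Γ γ e) _)) (≡-to-≅ (⟨resp⟩ T t e))

module _ {ℓ ℓ′} {Γ : Psh ℓ} (T : Ty Γ ℓ′) where
  open Psh Γ using (_·_)

  ContainsGenerators : ∀ {ℓr} → (∀ {W} (γ : Ob Γ W) → Fib T γ → Fib T γ → Set ℓr) →
                       Set (ℓ ⊔ ℓ′ ⊔ ℓr)
  ContainsGenerators Rel =
    ∀ {W} i .(fr : Fresh i W) (γ : Ob Γ W) (p : Fib T (γ · wk {W} i fr)) →
    Rel (γ · wk {W} i fr) p
        (subst (Fib T) (wkz-path T i fr γ) (_⟨_⟩ T p (zeroAt {W} i fr)))

  SE-least : ∀ {ℓr} (E : EqRel T ℓr) → ContainsGenerators (R E) →
             ∀ {W} {γ : Ob Γ W} {s t : Fib T γ} → SERel T γ s t → R E γ s t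
  SE-least E gens (gen i fr γ p) = gens i fr γ p
  SE-least E gens rfl            = IsEquivalence.refl (isEq E _)
  SE-least E gens (sym′ r)       = IsEquivalence.sym (isEq E _) (SE-least E gens r)
  SE-least E gens (trn r r′)     =
    IsEquivalence.trans (isEq E _) (SE-least E gens r) (SE-least E gens r′)
  SE-least E gens (rst φ r)      = stable E φ (SE-least E gens r)

module Substitution {ℓ₁ ℓ₂ ℓ′} {Δ : Psh ℓ₁} {Γ : Psh ℓ₂}
                    (σ : PshHom Δ Γ) (T : Ty Γ ℓ′) where
  open Psh Γ using (_·_)
  open Psh Δ using () renaming (_·_ to _·Δ_)
  open Ty T using () renaming (_⟨_⟩ to _↾_)
  open Restriction T

  Tσ : Ty Δ ℓ′
  Tσ = T [ σ ]ᵀ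

  open Ty Tσ using () renaming (_⟨_⟩ to _↾σ_)

  restrict-[σ] : ∀ {V W} {δ : Ob Δ W} (t : Fib Tσ δ) (φ : Hom V W) → t ↾σ φ ≅ t ↾ φ
  restrict-[σ] {δ = δ} t φ = transport-≅ (P.sym (nat σ δ φ)) (t ↾ φ)

  SE-generators-[σ] : ContainsGenerators Tσ (λ δ → SERel T (map σ δ))
  SE-generators-[σ] i fr δ p =
    ≅-transport (Fib T) (SERel T) (P.sym over) (transport-≅ over p) same-second
      (gen i fr (map σ δ) (subst (Fib T) over p))
    where
    over : map σ (δ ·Δ wk i fr) ≡ map σ δ · wk i fr
    over = nat σ δ (wk i fr)
    same-second :
      subst (Fib T) (wkz-path T i fr (map σ δ)) (subst (Fib T) over p ↾ zeroAt i fr)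
        ≅ subst (Fib Tσ) (wkz-path Tσ i fr δ) (p ↾σ zeroAt i fr)
    same-second = begin
      subst (Fib T) (wkz-path T i fr (map σ δ)) (subst (Fib T) over p ↾ zeroAt i fr)
        ≅⟨ transport-≅ (wkz-path T i fr (map σ δ)) _ ⟩
      subst (Fib T) over p ↾ zeroAt i fr
        ≅⟨ restrict-cong (zeroAt i fr) (P.sym over) (transport-≅ over p) ⟩
      p ↾ zeroAt i fr
        ≅⟨ restrict-[σ] p (zeroAt i fr) ⟨
      p ↾σ zeroAt i fr
        ≅⟨ ≡-subst-removable (Fib Tσ) (wkz-path Tσ i fr δ) _ ⟨
      subst (Fib Tσ) (wkz-path Tσ i fr δ) (p ↾σ zeroAt i fr)
        ∎
      where open ≅-Reasoning

  SE-[σ]⊇ : ∀ {W} {δ : Ob Δ W} {s t : Fib Tσ δ} → SERel Tσ δ s t → SERel T (map σ δ) s t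
  SE-[σ]⊇ = SE-least Tσ (SE T [ σ ]ᴱ) SE-generators-[σ]

  Pulled : ∀ {W} (γ : Ob Γ W) → Fib T γ → Fib T γ → Set (ℓ₁ ⊔ ℓ₂ ⊔ ℓ′)
  Pulled {W} γ s t = ∀ {V} (φ : Hom V W) (δ : Ob Δ V) (e : map σ δ ≡ γ · φ) →
    SERel Tσ δ (subst (Fib T) (P.sym e) (s ↾ φ)) (subst (Fib T) (P.sym e) (t ↾ φ))

  Pulled-stable : ∀ {V W} {γ : Ob Γ W} {s t : Fib T γ} (ψ : Hom V W) →
                  Pulled γ s t → Pulled (γ · ψ) (s ↾ ψ) (t ↾ ψ)
  Pulled-stable {γ = γ} ψ r φ δ e =
    ≅-transport (Fib Tσ) (SERel Tσ) refl (along-∘ _) (along-∘ _) (r (ψ ∘H φ) δ e∘)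
    where
    e∘ : map σ δ ≡ γ · (ψ ∘H φ)
    e∘ = P.trans e (P.sym (·-∘ Γ γ ψ φ))
    along-∘ : (u : Fib T γ) →
              subst (Fib T) (P.sym e∘) (u ↾ (ψ ∘H φ)) ≅ subst (Fib T) (P.sym e) ((u ↾ ψ) ↾ φ)
    along-∘ u = H.trans (transport-≅ (P.sym e∘) _)
               (H.trans (restrict-∘ u ψ φ) (H.sym (transport-≅ (P.sym e) _)))

  PulledRel : EqRel T (ℓ₁ ⊔ ℓ₂ ⊔ ℓ′)
  PulledRel = record
    { R      = Pulled
    ; isEq   = λ γ → record
      { refl  = λ φ δ e → rfl
      ; sym   = λ r φ δ e → sym′ (r φ δ e)
      ; trans = λ r r′ φ δ e → trn (r φ δ e) (r′ φ δ e)
      }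
    ; stable = Pulled-stable
    }

  -- The key step: to relate p⟨φ⟩ and p⟨0/i⟩⟨φ⟩ for φ : V → (W , i:P), factor φ
  -- through the generating square at a fresh name j for V and restrict the
  -- generating pair of T[σ] at δ·wk_j along `instantiate`.
  Pulled-generators : ContainsGenerators T Pulled
  Pulled-generators {W} i fr γ p {V} φ δ e =
    ≅-transport (Fib Tσ) (SERel Tσ) back same-first same-second
      (rst instantiate (gen j frj δ q))
    where
    j : ℕ
    j = freshName V
    frj : Fresh j V
    frj = freshName-fresh V
    open GeneratorSquare {W} i fr φ j frj

    over : map σ (δ ·Δ wkⱼ) ≡ (γ · wkᵢ) · rename
    over = begin
      map σ (δ ·Δ wkⱼ)          ≡⟨ nat σ δ wkⱼ ⟩
      map σ δ · wkⱼ             ≡⟨ cong (_· wkⱼ) e ⟩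
      ((γ · wkᵢ) · φ) · wkⱼ     ≡⟨ cong (_· wkⱼ) (·-∘ Γ γ wkᵢ φ) ⟨
      (γ · (wkᵢ ∘H φ)) · wkⱼ    ≡⟨ ·-∘ Γ γ (wkᵢ ∘H φ) wkⱼ ⟨
      γ · ((wkᵢ ∘H φ) ∘H wkⱼ)   ≡⟨ ·-resp Γ γ wk∘rename ⟨
      γ · (wkᵢ ∘H rename)       ≡⟨ ·-∘ Γ γ wkᵢ rename ⟩
      (γ · wkᵢ) · rename        ∎
      where open ≡-Reasoning

    over-zero : map σ (δ ·Δ wkⱼ) ≡ ((γ · wkᵢ) · rename) · zeroⱼ
    over-zero = begin
      map σ (δ ·Δ wkⱼ)               ≡⟨ cong (map σ) (wkz-path Tσ j frj δ) ⟨
      map σ ((δ ·Δ wkⱼ) ·Δ zeroⱼ)    ≡⟨ nat σ (δ ·Δ wkⱼ) zeroⱼ ⟩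
      map σ (δ ·Δ wkⱼ) · zeroⱼ       ≡⟨ cong (_· zeroⱼ) over ⟩
      ((γ · wkᵢ) · rename) · zeroⱼ   ∎
      where open ≡-Reasoning

    back : (δ ·Δ wkⱼ) ·Δ instantiate ≡ δ
    back = P.trans (P.sym (·-∘ Δ δ wkⱼ instantiate))
                   (P.trans (·-resp Δ δ wk∘instantiate) (·-id Δ δ))

    q : Fib Tσ (δ ·Δ wkⱼ)
    q = subst (Fib T) (P.sym over) (p ↾ rename)

    p₀ : Fib T (γ · wkᵢ)
    p₀ = subst (Fib T) (wkz-path T i fr γ) (p ↾ zeroᵢ)

    q₀ : Fib Tσ (δ ·Δ wkⱼ)
    q₀ = subst (Fib Tσ) (wkz-path Tσ j frj δ) (q ↾σ zeroⱼ)

    q₀-in-T : q₀ ≅ (p ↾ rename) ↾ zeroⱼ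
    q₀-in-T = begin
      q₀                         ≅⟨ ≡-subst-removable (Fib Tσ) (wkz-path Tσ j frj δ) _ ⟩
      q ↾σ zeroⱼ                 ≅⟨ restrict-[σ] q zeroⱼ ⟩
      q ↾ zeroⱼ                  ≅⟨ restrict-cong zeroⱼ over (transport-≅ (P.sym over) _) ⟩
      (p ↾ rename) ↾ zeroⱼ       ∎
      where open ≅-Reasoning

    same-first : q ↾σ instantiate ≅ subst (Fib T) (P.sym e) (p ↾ φ)
    same-first = begin
      q ↾σ instantiate               ≅⟨ restrict-[σ] q instantiate ⟩
      q ↾ instantiate                ≅⟨ restrict-cong instantiate over
                                          (transport-≅ (P.sym over) _) ⟩
      (p ↾ rename) ↾ instantiate     ≅⟨ restrict-∘ p rename instantiate ⟨
      p ↾ (rename ∘H instantiate)    ≅⟨ restrict-≈ p rename∘instantiate ⟩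
      p ↾ φ                          ≅⟨ transport-≅ (P.sym e) _ ⟨
      subst (Fib T) (P.sym e) (p ↾ φ) ∎
      where open ≅-Reasoning

    same-second : q₀ ↾σ instantiate ≅ subst (Fib T) (P.sym e) (p₀ ↾ φ)
    same-second = begin
      q₀ ↾σ instantiate                         ≅⟨ restrict-[σ] q₀ instantiate ⟩
      q₀ ↾ instantiate                          ≅⟨ restrict-cong instantiate over-zero q₀-in-T ⟩
      ((p ↾ rename) ↾ zeroⱼ) ↾ instantiate      ≅⟨ restrict-cong instantiate
                                                     (·-∘ Γ (γ · wkᵢ) rename zeroⱼ)
                                                     (restrict-∘ p rename zeroⱼ) ⟨
      (p ↾ (rename ∘H zeroⱼ)) ↾ instantiate     ≅⟨ restrict-∘ p (rename ∘H zeroⱼ) instantiate ⟨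
      p ↾ ((rename ∘H zeroⱼ) ∘H instantiate)    ≅⟨ restrict-≈ p rename∘zeroAt∘instantiate ⟩
      p ↾ (zeroᵢ ∘H φ)                          ≅⟨ restrict-∘ p zeroᵢ φ ⟩
      (p ↾ zeroᵢ) ↾ φ                           ≅⟨ restrict-cong φ (P.sym (wkz-path T i fr γ))
                                                     (transport-≅ (wkz-path T i fr γ) _) ⟨
      p₀ ↾ φ                                    ≅⟨ transport-≅ (P.sym e) _ ⟨
      subst (Fib T) (P.sym e) (p₀ ↾ φ)          ∎
      where open ≅-Reasoning

  SE-[σ]⊆ : ∀ {W} {δ : Ob Δ W} {s t : Fib Tσ δ} → SERel T (map σ δ) s t → SERel Tσ δ s t
  SE-[σ]⊆ {δ = δ} r =
    ≅-transport (Fib Tσ) (SERel Tσ) refl (along-id _) (along-id _)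
      (SE-least T PulledRel Pulled-generators r idH δ e)
    where
    e : map σ δ ≡ map σ δ · idH
    e = P.sym (·-id Γ (map σ δ))
    along-id : (u : Fib T (map σ δ)) → subst (Fib T) (P.sym e) (u ↾ idH) ≅ u
    along-id u = H.trans (transport-≅ (P.sym e) _) (restrict-id u)

mainTheorem12 : ∀ {ℓ₁ ℓ₂ ℓ′} {Δ : Psh ℓ₁} {Γ : Psh ℓ₂}
    (σ : PshHom Δ Γ) (T : Ty Γ ℓ′) →
    (SE T [ σ ]ᴱ) ≐ SE (T [ σ ]ᵀ)
mainTheorem12 σ T δ s t = mk⇔ SE-[σ]⊆ SE-[σ]⊇
  where open Substitution σ T
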